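{- Let $k\ge1$, let $H$ be a $2k$-meager hypergraph, let $X$ be a vertex set of cardinality $<k$, let $z_0$ be a vertex not in $\overline{X}$, and put $Y=\overline{X}\cup\{z_0\}$, $Z=\overline{Y}$, $p=\|Z\setminus Y\|$. Then $p<k$ and there is an ordering $z_1,\dots,z_p$ of $Z\setminus Y$ such that for every $j$ with $1\le j\le p$, $z_j$ is attracted by $Y\cup\{z_i:1\leq i<j\}$, and there is a unique hyperedge witnessing this attraction (i.e. a unique hyperedge $h$ with $z_j\in h$ and $h\setminus\{z_j\}\subseteq Y\cup\{z_i:1\le i<j\}$).
   Context: A hypergraph is a pair $H=(U,T)$ with $U$ a finite nonempty vertex set and $T$ a collection of 3-element subsets of $U$ (hyperedges). For nonempty $X\subseteq U$, $\|X\|$ is its cardinality and $[X]$ the number of hyperedges contained in $X$; $X$ is dense if $\|X\|\le2[X]$; $H$ is $l$-meager if it has no dense vertex sets of cardinality $\le 2l$. A vertex set $X$ attracts a vertex $y$ if there are $x_1,x_2\in X$ with $\{x_1,x_2,y\}\in T$; such a hyperedge witnesses the attraction. $X$ is closed if it contains every vertex it attracts; the closure $\overline{X}$ is the least closed set containing $X$. -}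

module Defs where

open import Data.Nat using (ℕ; _≤_; _<_; _*_)
open import Data.Fin using (Fin)
open import Data.Fin.Subset using (Subset; _∈_; _∉_; _⊆_; _∪_; ⁅_⁆; ⊥; ∣_∣; Nonempty)
open import Data.Fin.Subset.Properties using (_⊆?_)
open import Data.List using (List; length; filter; foldr)
open import Data.List.Relation.Unary.All using (All)
open import Data.List.Relation.Unary.Unique.Propositional using (Unique)
import Data.List.Membership.Propositional as LM
open import Data.Product using (∃; ∃-syntax; _×_)
open import Relation.Binary.PropositionalEquality using (_≡_)
open import Relation.Nullary using (¬_)

-- A hypergraph H = (U, T) with U = Fin n (nonemptiness of U is imposed
-- in the theorem by 1 ≤ n) and T a duplicate-free list of 3-element
-- subsets of U (i.e. a finite set of 3-element subsets).
record Hypergraph (n : ℕ) : Set where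
  field
    edges      : List (Subset n)
    edges-3    : All (λ h → ∣ h ∣ ≡ 3) edges
    edges-uniq : Unique edges

open Hypergraph public

module _ {n : ℕ} (H : Hypergraph n) where

  edgeCount : Subset n → ℕ
  edgeCount X = length (filter (_⊆? X) (edges H))

  Dense : Subset n → Set
  Dense X = ∣ X ∣ ≤ 2 * edgeCount X

  Meager : ℕ → Set
  Meager l = ∀ (X : Subset n) → Nonempty X → ∣ X ∣ ≤ 2 * l → ¬ Dense X

  Attracts : Subset n → Fin n → Set
  Attracts X y = ∃[ x₁ ] ∃[ x₂ ] (x₁ ∈ X × x₂ ∈ X × (⁅ x₁ ⁆ ∪ ⁅ x₂ ⁆ ∪ ⁅ y ⁆) LM.∈ edges H)

  Witnesses : Subset n → Fin n → Subset n → Set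
  Witnesses X y h = h LM.∈ edges H × y ∈ h × (∀ v → v ∈ h → ¬ v ≡ y → v ∈ X)

  Closed : Subset n → Set
  Closed X = ∀ y → Attracts X y → y ∈ X

  IsClosure : Subset n → Subset n → Set
  IsClosure X C = Closed C × X ⊆ C × (∀ D → Closed D → X ⊆ D → C ⊆ D)

listSet : ∀ {n} → List (Fin n) → Subset n
listSet = foldr (λ v S → ⁅ v ⁆ ∪ S) ⊥

-- Adjoining attracted vertices one at a time computes a closure: X̄ = X ∪ {x₁,…,x_m} and
-- Z = Y ∪ {z₁,…,z_p}, each step being witnessed by a hyperedge that is new at that step.
-- Counting vertices against these hyperedges, meagerness forbids more than |X| steps from X
-- (so m ≤ |X|) and, since Y already carries the m hyperedges of X̄ while |Y| ≤ |X| + m + 1,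
-- more than |X| steps from Y; hence p ≤ |X| < k.
-- For uniqueness: X̄ is closed, so the two other vertices of an attracting hyperedge are not
-- both in X̄. Hence z₀ together with the attracting hyperedges of z₁,…,z_j spans at most
-- 2j + 1 vertices, and a second witness for z_j would add at most one more: j + 1 hyperedges
-- on at most 2j + 2 ≤ 4k vertices, a dense set.
module Submission where

open import Defs
open import Data.Bool using (true; false)
import Data.Bool as Bool
open import Data.Fin using (Fin; zero; suc; toℕ)
open import Data.Fin.Properties using (any?) renaming (_≟_ to _≟ᶠ_)
open import Data.Fin.Subset
open import Data.Fin.Subset.Properties
open import Data.List using (List; []; _∷_; length; lookup; take; _++_)
open import Data.List.Properties using (length-++; length-take; length-removeAt′)
import Data.List.Relation.Unary.All as All
open import Data.List.Relation.Unary.All.Properties using (¬Any⇒All¬)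
open import Data.List.Relation.Unary.Any using (here; there; index)
open import Data.List.Relation.Unary.AllPairs using ([]; _∷_)
open import Data.List.Relation.Unary.Unique.Propositional using (Unique)
open import Data.List.Relation.Unary.Unique.Propositional.Properties using (++⁺)
import Data.List.Membership.Propositional as LM
import Data.List.Membership.DecPropositional as DecLM
open import Data.List.Membership.Propositional.Properties using (∈-filter⁺; ∈-++⁻)
open import Data.Nat using (ℕ; zero; suc; _+_; _*_; _≤_; _<_; _≤?_; z≤n; s≤s; z<s)
open import Data.Nat.Properties
open import Data.Nat.Tactic.RingSolver using (solve-∀)
open import Data.Product using (∃₂; ∃-syntax; _×_; _,_; proj₁)
open import Data.Sum using (_⊎_; inj₁; inj₂; [_,_]′)
open import Data.Vec using ([]; _∷_; here; there)
open import Data.Vec.Properties using (≡-dec)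
open import Function using (_∘_)
open import Function.Bundles using (_⇔_; mk⇔; Equivalence)
open import Relation.Binary.Definitions using (DecidableEquality)
open import Relation.Binary.PropositionalEquality
open import Relation.Nullary using (Dec; yes; no; ¬_; contradiction)
open import Relation.Nullary.Decidable using (_×-dec_; ¬?; decidable-stable)

_≟ˢ_ : ∀ {n} → DecidableEquality (Subset n)
_≟ˢ_ = ≡-dec Bool._≟_

t<k⇒2t+1+t+1≤4k : ∀ {t k} → t < k → suc (2 * t) + suc t ≤ 2 * (2 * k)
t<k⇒2t+1+t+1≤4k {t} {k} t<k = begin
  suc (2 * t) + suc t       ≤⟨ n≤1+n _ ⟩
  suc (suc (2 * t) + suc t) ≡⟨ regroup t ⟩
  3 * suc t                 ≤⟨ *-monoʳ-≤ 3 t<k ⟩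
  3 * k                     ≤⟨ *-monoˡ-≤ k (n≤1+n 3) ⟩
  4 * k                     ≡⟨ *-assoc 2 2 k ⟩
  2 * (2 * k)               ∎
  where
  open ≤-Reasoning
  regroup : ∀ t → suc (suc (2 * t) + suc t) ≡ 3 * suc t
  regroup = solve-∀

∣p∪q∣≤∣p∣+∣q∣ : ∀ {n} (p q : Subset n) → ∣ p ∪ q ∣ ≤ ∣ p ∣ + ∣ q ∣
∣p∪q∣≤∣p∣+∣q∣ []          []          = z≤n
∣p∪q∣≤∣p∣+∣q∣ (true ∷ p)  (true ∷ q)  =
  s≤s (≤-trans (∣p∪q∣≤∣p∣+∣q∣ p q) (+-monoʳ-≤ ∣ p ∣ (n≤1+n ∣ q ∣)))
∣p∪q∣≤∣p∣+∣q∣ (true ∷ p)  (false ∷ q) = s≤s (∣p∪q∣≤∣p∣+∣q∣ p q)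
∣p∪q∣≤∣p∣+∣q∣ (false ∷ p) (true ∷ q)  =
  ≤-trans (s≤s (∣p∪q∣≤∣p∣+∣q∣ p q)) (≤-reflexive (sym (+-suc ∣ p ∣ ∣ q ∣)))
∣p∪q∣≤∣p∣+∣q∣ (false ∷ p) (false ∷ q) = ∣p∪q∣≤∣p∣+∣q∣ p q

x∈p─q⇒x∉q : ∀ {n} (p q : Subset n) {x} → x ∈ p ─ q → x ∉ q
x∈p─q⇒x∉q (true ∷ p)  (false ∷ q) here      ()
x∈p─q⇒x∉q (_ ∷ p)     (true ∷ q)  (there i) (there j) = x∈p─q⇒x∉q p q i j
x∈p─q⇒x∉q (_ ∷ p)     (false ∷ q) (there i) (there j) = x∈p─q⇒x∉q p q i j

x∈p⇒∣p∣≡1+∣p-x∣ : ∀ {n} (p : Subset n) {x} → x ∈ p → ∣ p ∣ ≡ suc ∣ p - x ∣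
x∈p⇒∣p∣≡1+∣p-x∣ (true ∷ p)  here      = cong (suc ∘ ∣_∣) (sym (p─⊥≡p p))
x∈p⇒∣p∣≡1+∣p-x∣ (true ∷ p)  (there i) = cong suc (x∈p⇒∣p∣≡1+∣p-x∣ p i)
x∈p⇒∣p∣≡1+∣p-x∣ (false ∷ p) (there i) = x∈p⇒∣p∣≡1+∣p-x∣ p i

module _ {n : ℕ} where

  ∪-least : ∀ {p q r : Subset n} → p ⊆ r → q ⊆ r → p ∪ q ⊆ r
  ∪-least {p} {q} p⊆r q⊆r x∈p∪q with x∈p∪q⁻ p q x∈p∪q
  ... | inj₁ x∈p = p⊆r x∈p
  ... | inj₂ x∈q = q⊆r x∈q

  ∪-monoˡ-⊆ : ∀ {p q r : Subset n} → p ⊆ q → p ∪ r ⊆ q ∪ r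
  ∪-monoˡ-⊆ {p} {q} {r} p⊆q = ∪-least (p⊆p∪q r ∘ p⊆q) (q⊆p∪q q r)

  x∈p⇒⁅x⁆⊆p : ∀ {p : Subset n} {x} → x ∈ p → ⁅ x ⁆ ⊆ p
  x∈p⇒⁅x⁆⊆p {x = x} x∈p y∈⁅x⁆ = subst (_∈ _) (sym (x∈⁅y⁆⇒x≡y x y∈⁅x⁆)) x∈p

  ∣p∪⁅x⁆∣≤1+∣p∣ : ∀ (p : Subset n) x → ∣ p ∪ ⁅ x ⁆ ∣ ≤ suc ∣ p ∣
  ∣p∪⁅x⁆∣≤1+∣p∣ p x = begin
    ∣ p ∪ ⁅ x ⁆ ∣       ≤⟨ ∣p∪q∣≤∣p∣+∣q∣ p ⁅ x ⁆ ⟩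
    ∣ p ∣ + ∣ ⁅ x ⁆ ∣   ≡⟨ cong (∣ p ∣ +_) (∣⁅x⁆∣≡1 x) ⟩
    ∣ p ∣ + 1           ≡⟨ +-comm ∣ p ∣ 1 ⟩
    suc ∣ p ∣           ∎
    where open ≤-Reasoning

  x∉p⇒∣p∣<∣p∪⁅x⁆∣ : ∀ {p : Subset n} {x} → x ∉ p → ∣ p ∣ < ∣ p ∪ ⁅ x ⁆ ∣
  x∉p⇒∣p∣<∣p∪⁅x⁆∣ {x = x} x∉p = p⊂q⇒∣p∣<∣q∣ (p⊆p∪q ⁅ x ⁆ , x , q⊆p∪q _ _ (x∈⁅x⁆ x) , x∉p)

  ∣p∣≡1+m⇒∃x∈p : ∀ (p : Subset n) {m} → ∣ p ∣ ≡ suc m → ∃[ x ] (x ∈ p × ∣ p - x ∣ ≡ m)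
  ∣p∣≡1+m⇒∃x∈p p eq with nonempty? p
  ... | yes (x , x∈p) = x , x∈p , suc-injective (trans (sym (x∈p⇒∣p∣≡1+∣p-x∣ p x∈p)) eq)
  ... | no empty =
    contradiction (trans (sym eq) (trans (cong ∣_∣ (Empty-unique empty)) (∣⊥∣≡0 n))) λ ()

  ∣p∣≡0⇒p≡⊥ : ∀ (p : Subset n) → ∣ p ∣ ≡ 0 → p ≡ ⊥
  ∣p∣≡0⇒p≡⊥ p eq with nonempty? p
  ... | yes (x , x∈p) = contradiction (trans (sym eq) (x∈p⇒∣p∣≡1+∣p-x∣ p x∈p)) λ ()
  ... | no empty = Empty-unique empty

  ∪-pair-anchor : ∀ {A W : Subset n} {x₁ x₂} → x₁ ∈ A ∪ W → x₂ ∈ A ∪ W → ¬ (x₁ ∈ A × x₂ ∈ A) →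
    ∃[ a ] (x₁ ∈ W ∪ ⁅ a ⁆ × x₂ ∈ W ∪ ⁅ a ⁆)
  ∪-pair-anchor {A} {W} {x₁} {x₂} x₁∈ x₂∈ not-both with x∈p∪q⁻ A W x₁∈ | x∈p∪q⁻ A W x₂∈
  ... | inj₁ x₁∈A | inj₁ x₂∈A = contradiction (x₁∈A , x₂∈A) not-both
  ... | inj₁ _    | inj₂ x₂∈W = x₁ , q⊆p∪q W _ (x∈⁅x⁆ x₁) , p⊆p∪q _ x₂∈W
  ... | inj₂ x₁∈W | _         = x₂ , p⊆p∪q _ x₁∈W , q⊆p∪q W _ (x∈⁅x⁆ x₂)

triangle : ∀ {n} → Fin n → Fin n → Fin n → Subset n
triangle x y z = ⁅ x ⁆ ∪ ⁅ y ⁆ ∪ ⁅ z ⁆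

module _ {n : ℕ} {x y z : Fin n} where

  x∈triangle : x ∈ triangle x y z
  x∈triangle = p⊆p∪q _ (x∈⁅x⁆ x)

  y∈triangle : y ∈ triangle x y z
  y∈triangle = q⊆p∪q ⁅ x ⁆ _ (p⊆p∪q _ (x∈⁅x⁆ y))

  z∈triangle : z ∈ triangle x y z
  z∈triangle = q⊆p∪q ⁅ x ⁆ _ (q⊆p∪q ⁅ y ⁆ _ (x∈⁅x⁆ z))

  triangle-⊆ : ∀ {p : Subset n} → x ∈ p → y ∈ p → z ∈ p → triangle x y z ⊆ p
  triangle-⊆ x∈p y∈p z∈p = ∪-least (x∈p⇒⁅x⁆⊆p x∈p) (∪-least (x∈p⇒⁅x⁆⊆p y∈p) (x∈p⇒⁅x⁆⊆p z∈p))

  v∈triangle∧v≢z⇒v≡x⊎v≡y : ∀ {v} → v ∈ triangle x y z → v ≢ z → v ≡ x ⊎ v ≡ y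
  v∈triangle∧v≢z⇒v≡x⊎v≡y v∈ v≢z with x∈p∪q⁻ ⁅ x ⁆ _ v∈
  ... | inj₁ v∈⁅x⁆ = inj₁ (x∈⁅y⁆⇒x≡y x v∈⁅x⁆)
  ... | inj₂ v∈⁅y,z⁆ with x∈p∪q⁻ ⁅ y ⁆ _ v∈⁅y,z⁆
  ...   | inj₁ v∈⁅y⁆ = inj₂ (x∈⁅y⁆⇒x≡y y v∈⁅y⁆)
  ...   | inj₂ v∈⁅z⁆ = contradiction (x∈⁅y⁆⇒x≡y z v∈⁅z⁆) v≢z

  p-z-x-y≡⊥⇒p⊆triangle : ∀ {p : Subset n} → p - z - x - y ≡ ⊥ → p ⊆ triangle x y z
  p-z-x-y≡⊥⇒p⊆triangle {p} rest≡⊥ {v} v∈p with v ≟ᶠ z | v ≟ᶠ x | v ≟ᶠ y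
  ... | yes refl | _        | _        = z∈triangle
  ... | no _     | yes refl | _        = x∈triangle
  ... | no _     | no _     | yes refl = y∈triangle
  ... | no v≢z   | no v≢x   | no v≢y   = contradiction
        (subst (v ∈_) rest≡⊥ (x∈p∧x≢y⇒x∈p-y (x∈p∧x≢y⇒x∈p-y (x∈p∧x≢y⇒x∈p-y v∈p v≢z) v≢x) v≢y))
        ∉⊥

∣h∣≡3⇒triangle : ∀ {n} {h : Subset n} {z} → ∣ h ∣ ≡ 3 → z ∈ h →
  ∃₂ λ a b → a ∈ h - z × b ∈ h - z × h ≡ triangle a b z
∣h∣≡3⇒triangle {h = h} {z} ∣h∣≡3 z∈h =
  let ∣h-z∣≡2 = suc-injective (trans (sym (x∈p⇒∣p∣≡1+∣p-x∣ h z∈h)) ∣h∣≡3)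
      a , a∈h-z , ∣h-z-a∣≡1 = ∣p∣≡1+m⇒∃x∈p (h - z) ∣h-z∣≡2
      b , b∈h-z-a , ∣h-z-a-b∣≡0 = ∣p∣≡1+m⇒∃x∈p (h - z - a) ∣h-z-a∣≡1
      b∈h-z = p─q⊆p (h - z) ⁅ a ⁆ b∈h-z-a
      a∈h = p─q⊆p h ⁅ z ⁆ a∈h-z
      b∈h = p─q⊆p h ⁅ z ⁆ b∈h-z
  in a , b , a∈h-z , b∈h-z ,
     ⊆-antisym (p-z-x-y≡⊥⇒p⊆triangle (∣p∣≡0⇒p≡⊥ _ ∣h-z-a-b∣≡0)) (triangle-⊆ a∈h b∈h z∈h)

listSet⁺ : ∀ {n} {vs : List (Fin n)} {v} → v LM.∈ vs → v ∈ listSet vs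
listSet⁺ (here refl) = p⊆p∪q _ (x∈⁅x⁆ _)
listSet⁺ (there v∈vs) = q⊆p∪q _ _ (listSet⁺ v∈vs)

listSet⁻ : ∀ {n} (vs : List (Fin n)) {v} → v ∈ listSet vs → v LM.∈ vs
listSet⁻ [] v∈⊥ = contradiction v∈⊥ ∉⊥
listSet⁻ (w ∷ vs) v∈ with x∈p∪q⁻ ⁅ w ⁆ (listSet vs) v∈
... | inj₁ v∈⁅w⁆ = here (x∈⁅y⁆⇒x≡y w v∈⁅w⁆)
... | inj₂ v∈vs  = there (listSet⁻ vs v∈vs)

∣listSet∣≤length : ∀ {n} (vs : List (Fin n)) → ∣ listSet vs ∣ ≤ length vs
∣listSet∣≤length {n} [] = ≤-reflexive (∣⊥∣≡0 n)
∣listSet∣≤length (v ∷ vs) = begin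
  ∣ ⁅ v ⁆ ∪ listSet vs ∣  ≡⟨ cong ∣_∣ (∪-comm ⁅ v ⁆ (listSet vs)) ⟩
  ∣ listSet vs ∪ ⁅ v ⁆ ∣  ≤⟨ ∣p∪⁅x⁆∣≤1+∣p∣ (listSet vs) v ⟩
  suc ∣ listSet vs ∣      ≤⟨ s≤s (∣listSet∣≤length vs) ⟩
  suc (length vs)         ∎
  where open ≤-Reasoning

module _ {a} {A : Set a} where

  ∈-─⁺ : ∀ {x y : A} {ys} (x∈ys : x LM.∈ ys) → y LM.∈ ys → y ≢ x → y LM.∈ ys LM.─ x∈ys
  ∈-─⁺ (here refl) (here refl) y≢x = contradiction refl y≢x
  ∈-─⁺ (here refl) (there y∈ys) _  = y∈ys
  ∈-─⁺ (there x∈ys) (here refl) _  = here refl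
  ∈-─⁺ (there x∈ys) (there y∈ys) y≢x = there (∈-─⁺ x∈ys y∈ys y≢x)

  Unique⇒length≤ : ∀ {xs ys : List A} → Unique xs → (∀ {x} → x LM.∈ xs → x LM.∈ ys) →
    length xs ≤ length ys
  Unique⇒length≤ {[]} _ _ = z≤n
  Unique⇒length≤ {x ∷ xs} {ys} (x∉xs ∷ xs-unique) xs⊆ys = begin
    suc (length xs)             ≤⟨ s≤s (Unique⇒length≤ xs-unique xs⊆ys─x) ⟩
    suc (length (ys LM.─ x∈ys)) ≡⟨ sym (length-removeAt′ ys (index x∈ys)) ⟩
    length ys                   ∎
    where
    open ≤-Reasoning
    x∈ys = xs⊆ys (here refl)
    xs⊆ys─x : ∀ {y} → y LM.∈ xs → y LM.∈ ys LM.─ x∈ys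
    xs⊆ys─x y∈xs = ∈-─⁺ x∈ys (xs⊆ys (there y∈xs)) (≢-sym (All.lookup x∉xs y∈xs))

data Chain {n} (P : Subset n → Fin n → Set) : Subset n → List (Fin n) → Set where
  []  : ∀ {B} → Chain P B []
  _∷_ : ∀ {B z zs} → P B z → Chain P (B ∪ ⁅ z ⁆) zs → Chain P B (z ∷ zs)

module _ {n} {P : Subset n → Fin n → Set} where

  Chain-take : ∀ {B zs} t → Chain P B zs → Chain P B (take t zs)
  Chain-take zero    c       = []
  Chain-take (suc t) []      = []
  Chain-take (suc t) (p ∷ c) = p ∷ Chain-take t c

  Chain-lookup : ∀ {B zs} → Chain P B zs → (j : Fin (length zs)) →
    P (B ∪ listSet (take (toℕ j) zs)) (lookup zs j)
  Chain-lookup {B} (p ∷ c) zero = subst (λ S → P S _) (sym (∪-identityʳ B)) p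
  Chain-lookup {B} {z ∷ zs} (p ∷ c) (suc j) =
    subst (λ S → P S (lookup zs j)) (∪-assoc B ⁅ z ⁆ (listSet (take (toℕ j) zs))) (Chain-lookup c j)

module _ {n : ℕ} (H : Hypergraph n) where

  record EdgesIn (S : Subset n) (E : List (Subset n)) : Set where
    field
      E-unique : Unique E
      E⊆edges  : ∀ {e} → e LM.∈ E → e LM.∈ edges H
      E⊆S      : ∀ {e} → e LM.∈ E → e ⊆ S

  open EdgesIn

  EdgesIn-[] : ∀ {S} → EdgesIn S []
  EdgesIn-[] = record { E-unique = [] ; E⊆edges = λ () ; E⊆S = λ () }

  EdgesIn-∷ : ∀ {S E e} → e LM.∈ edges H → e ⊆ S → ¬ e LM.∈ E → EdgesIn S E → EdgesIn S (e ∷ E)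
  EdgesIn-∷ {E = E} e∈edges e⊆S e∉E E-in = record
    { E-unique = ¬Any⇒All¬ E e∉E ∷ E-unique E-in
    ; E⊆edges  = λ { (here refl) → e∈edges ; (there f∈E) → E⊆edges E-in f∈E }
    ; E⊆S      = λ { (here refl) → e⊆S ; (there f∈E) → E⊆S E-in f∈E }
    }

  EdgesIn-++ : ∀ {S E₁ E₂} → EdgesIn S E₁ → EdgesIn S E₂ →
    (∀ {e} → e LM.∈ E₁ → ¬ e LM.∈ E₂) → EdgesIn S (E₁ ++ E₂)
  EdgesIn-++ {E₁ = E₁} E₁-in E₂-in disjoint = record
    { E-unique = ++⁺ (E-unique E₁-in) (E-unique E₂-in) λ (e∈E₁ , e∈E₂) → disjoint e∈E₁ e∈E₂
    ; E⊆edges  = λ e∈ → [ E⊆edges E₁-in , E⊆edges E₂-in ]′ (∈-++⁻ E₁ e∈)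
    ; E⊆S      = λ e∈ → [ E⊆S E₁-in , E⊆S E₂-in ]′ (∈-++⁻ E₁ e∈)
    }

  EdgesIn-mono : ∀ {S S′ E} → S ⊆ S′ → EdgesIn S E → EdgesIn S′ E
  EdgesIn-mono S⊆S′ E-in = record
    { E-unique = E-unique E-in ; E⊆edges = E⊆edges E-in ; E⊆S = λ e∈E → S⊆S′ ∘ E⊆S E-in e∈E }

  length≤edgeCount : ∀ {S E} → EdgesIn S E → length E ≤ edgeCount H S
  length≤edgeCount {S} E-in = Unique⇒length≤ (E-unique E-in)
    (λ e∈E → ∈-filter⁺ (_⊆? S) (E⊆edges E-in e∈E) (E⊆S E-in e∈E))

  meager⇒sparse : ∀ {l S E} → Meager H l → Nonempty S → ∣ S ∣ ≤ 2 * l → EdgesIn S E →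
    2 * length E < ∣ S ∣
  meager⇒sparse {S = S} meager nonempty small E-in = ≰⇒> λ dense →
    meager S nonempty small (≤-trans dense (*-monoʳ-≤ 2 (length≤edgeCount E-in)))

  Attracts? : ∀ B y → Dec (Attracts H B y)
  Attracts? B y = any? λ x₁ → any? λ x₂ →
    x₁ ∈? B ×-dec x₂ ∈? B ×-dec DecLM._∈?_ _≟ˢ_ (triangle x₁ x₂ y) (edges H)

  Attracts-mono : ∀ {B D y} → B ⊆ D → Attracts H B y → Attracts H D y
  Attracts-mono B⊆D (x₁ , x₂ , x₁∈B , x₂∈B , e∈edges) = x₁ , x₂ , B⊆D x₁∈B , B⊆D x₂∈B , e∈edges

  attractingEdge : ∀ {B z} → Attracts H B z → Subset n
  attractingEdge {z = z} (x₁ , x₂ , _) = triangle x₁ x₂ z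

  attractingEdge-witnesses : ∀ {B z} (att : Attracts H B z) → Witnesses H B z (attractingEdge att)
  attractingEdge-witnesses (x₁ , x₂ , x₁∈B , x₂∈B , e∈edges) = e∈edges , z∈triangle , others∈B
    where
    others∈B : ∀ v → v ∈ triangle x₁ x₂ _ → v ≢ _ → v ∈ _
    others∈B v v∈e v≢z with v∈triangle∧v≢z⇒v≡x⊎v≡y v∈e v≢z
    ... | inj₁ refl = x₁∈B
    ... | inj₂ refl = x₂∈B

  Witnesses⇒⊆∪ : ∀ {B z h} → Witnesses H B z h → h ⊆ B ∪ ⁅ z ⁆
  Witnesses⇒⊆∪ {B} {z} (_ , _ , others∈B) {v} v∈h with v ≟ᶠ z
  ... | yes refl = q⊆p∪q B _ (x∈⁅x⁆ z)
  ... | no v≢z   = p⊆p∪q _ (others∈B v v∈h v≢z)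

  Witnesses⇒⊈ : ∀ {B z h} → z ∉ B → Witnesses H B z h → ¬ h ⊆ B
  Witnesses⇒⊈ z∉B (_ , z∈h , _) h⊆B = z∉B (h⊆B z∈h)

  Witnesses⇒triangle : ∀ {B z h} → Witnesses H B z h →
    ∃₂ λ a b → a ∈ B × b ∈ B × h ≡ triangle a b z
  Witnesses⇒triangle (h∈edges , z∈h , others∈B) =
    let a , b , a∈h-z , b∈h-z , h≡ = ∣h∣≡3⇒triangle (All.lookup (edges-3 H) h∈edges) z∈h
        other∈B : ∀ {v} → v ∈ _ - _ → v ∈ _
        other∈B v∈h-z = others∈B _ (p─q⊆p _ _ v∈h-z) (x∉⁅y⁆⇒x≢y (x∈p─q⇒x∉q _ _ v∈h-z))
    in a , b , other∈B a∈h-z , other∈B b∈h-z , h≡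

  NewlyAttracted : Subset n → Fin n → Set
  NewlyAttracted B z = z ∉ B × Attracts H B z

  UniquelyAttracted : Subset n → Fin n → Set
  UniquelyAttracted B z =
    Attracts H B z × ∃[ h ] (Witnesses H B z h × (∀ h′ → Witnesses H B z h′ → h′ ≡ h))

  ClosureChain : Subset n → Set
  ClosureChain B = ∃[ zs ] (Chain NewlyAttracted B zs × Closed H (B ∪ listSet zs))

  closureChain : ∀ B → ClosureChain B
  closureChain B = grow n B (m≤m+n n ∣ B ∣)
    where
    -- Each step enlarges B, which has at most n elements, so n units of fuel suffice.
    grow : ∀ fuel B → n ≤ fuel + ∣ B ∣ → ClosureChain B
    grow fuel B bound with any? (λ z → ¬? (z ∈? B) ×-dec Attracts? B z)
    ... | no none = [] , [] , subst (Closed H) (sym (∪-identityʳ B)) B-closed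
      where
      B-closed : Closed H B
      B-closed y att = decidable-stable (y ∈? B) λ y∉B → none (y , y∉B , att)
    ... | yes (z , z∉B , att) with fuel
    ...   | zero = contradiction (≤-trans (∣p∣≤n (B ∪ ⁅ z ⁆)) bound) (<⇒≱ (x∉p⇒∣p∣<∣p∪⁅x⁆∣ z∉B))
    ...   | suc fuel =
      let bound′ = ≤-trans bound (≤-trans (≤-reflexive (sym (+-suc fuel ∣ B ∣)))
                                          (+-monoʳ-≤ fuel (x∉p⇒∣p∣<∣p∪⁅x⁆∣ z∉B)))
          zs , c , closed = grow fuel (B ∪ ⁅ z ⁆) bound′
      in z ∷ zs , (z∉B , att) ∷ c , subst (Closed H) (∪-assoc B ⁅ z ⁆ (listSet zs)) closed

  chain-∉ : ∀ {B zs v} → Chain NewlyAttracted B zs → v LM.∈ zs → v ∉ B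
  chain-∉ ((z∉B , _) ∷ c) (here refl) = z∉B
  chain-∉ (_ ∷ c) (there v∈zs) v∈B = chain-∉ c v∈zs (p⊆p∪q _ v∈B)

  chain-unique : ∀ {B zs} → Chain NewlyAttracted B zs → Unique zs
  chain-unique [] = []
  chain-unique {B} {z ∷ zs} (_ ∷ c) =
    ¬Any⇒All¬ zs (λ z∈zs → chain-∉ c z∈zs (q⊆p∪q B _ (x∈⁅x⁆ z))) ∷ chain-unique c

  chain-new⇔ : ∀ {B zs} → Chain NewlyAttracted B zs → ∀ v → v ∈ (B ∪ listSet zs) ─ B ⇔ v LM.∈ zs
  chain-new⇔ {B} {zs} c v = mk⇔ to from
    where
    to : v ∈ (B ∪ listSet zs) ─ B → v LM.∈ zs
    to v∈ with x∈p∪q⁻ B (listSet zs) (p─q⊆p _ B v∈)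
    ... | inj₁ v∈B  = contradiction v∈B (x∈p─q⇒x∉q _ B v∈)
    ... | inj₂ v∈zs = listSet⁻ zs v∈zs
    from : v LM.∈ zs → v ∈ (B ∪ listSet zs) ─ B
    from v∈zs = x∈p∧x∉q⇒x∈p─q (q⊆p∪q B _ (listSet⁺ v∈zs)) (chain-∉ c v∈zs)

  chain⊆closed : ∀ {B D zs} → Chain NewlyAttracted B zs → Closed H D → B ⊆ D → listSet zs ⊆ D
  chain⊆closed [] _ _ = ⊥⊆
  chain⊆closed ((_ , att) ∷ c) D-closed B⊆D =
    let z∈D = D-closed _ (Attracts-mono B⊆D att)
    in ∪-least (x∈p⇒⁅x⁆⊆p z∈D) (chain⊆closed c D-closed (∪-least B⊆D (x∈p⇒⁅x⁆⊆p z∈D)))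

  closure≡chain : ∀ {B C zs} → IsClosure H B C → Chain NewlyAttracted B zs →
    Closed H (B ∪ listSet zs) → C ≡ B ∪ listSet zs
  closure≡chain (C-closed , B⊆C , least) c closed =
    ⊆-antisym (least _ closed (p⊆p∪q _)) (∪-least B⊆C (chain⊆closed c C-closed B⊆C))

  chainEdges : ∀ {B zs} → Chain NewlyAttracted B zs → List (Subset n)
  chainEdges []              = []
  chainEdges ((_ , att) ∷ c) = attractingEdge att ∷ chainEdges c

  chainEdges-length : ∀ {B zs} (c : Chain NewlyAttracted B zs) → length (chainEdges c) ≡ length zs
  chainEdges-length []      = refl
  chainEdges-length (_ ∷ c) = cong suc (chainEdges-length c)

  chainEdges-⊈ : ∀ {B zs e} (c : Chain NewlyAttracted B zs) → e LM.∈ chainEdges c → ¬ e ⊆ B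
  chainEdges-⊈ ((z∉B , att) ∷ c) (here refl) = Witnesses⇒⊈ z∉B (attractingEdge-witnesses att)
  chainEdges-⊈ (_ ∷ c) (there e∈) e⊆B = chainEdges-⊈ c e∈ (p⊆p∪q _ ∘ e⊆B)

  chainEdges-in : ∀ {B zs} (c : Chain NewlyAttracted B zs) → EdgesIn (B ∪ listSet zs) (chainEdges c)
  chainEdges-in [] = EdgesIn-[]
  chainEdges-in {B} {z ∷ zs} ((_ , att) ∷ c) =
    EdgesIn-∷ (proj₁ witness) (B∪z⊆ ∘ Witnesses⇒⊆∪ witness)
      (λ e∈ → chainEdges-⊈ c e∈ (Witnesses⇒⊆∪ witness))
      (EdgesIn-mono (⊆-reflexive (∪-assoc B ⁅ z ⁆ (listSet zs))) (chainEdges-in c))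
    where
    witness = attractingEdge-witnesses att
    B∪z⊆ : B ∪ ⁅ z ⁆ ⊆ B ∪ listSet (z ∷ zs)
    B∪z⊆ = ⊆-trans (p⊆p∪q (listSet zs)) (⊆-reflexive (∪-assoc B ⁅ z ⁆ (listSet zs)))

  module _ {k : ℕ} (meager : Meager H (2 * k)) where

    -- Otherwise B and the first t + 1 steps span at most |B| + t + 1 vertices: at most twice
    -- the number |EB| + t + 1 of hyperedges of EB and of those steps, and at most 3t + 2 < 4k.
    chain-short : ∀ {B zs EB} → Chain NewlyAttracted B zs → EdgesIn B EB → ∀ t → t < k →
      ∣ B ∣ ≤ suc t + 2 * length EB → ∣ B ∣ ≤ suc (2 * t) → length zs ≤ t
    chain-short [] _ _ _ _ _ = z≤n
    chain-short {B} {z ∷ zs} {EB} c EB-in t t<k ∣B∣≤ ∣B∣≤′ with length (z ∷ zs) ≤? t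
    ... | yes short = short
    ... | no long =
      contradiction (meager⇒sparse {l = 2 * k} meager (z , z∈S) ∣S∣≤4k S-edges) (≤⇒≯ ∣S∣≤2∣E∣)
      where
      prefix = take (suc t) (z ∷ zs)
      c′ = Chain-take (suc t) c
      length-prefix : length prefix ≡ suc t
      length-prefix = trans (length-take (suc t) (z ∷ zs)) (m≤n⇒m⊓n≡m (≰⇒> long))
      S = B ∪ listSet prefix
      E = EB ++ chainEdges c′
      z∈S : z ∈ S
      z∈S = q⊆p∪q B _ (p⊆p∪q _ (x∈⁅x⁆ z))
      S-edges : EdgesIn S E
      S-edges = EdgesIn-++ (EdgesIn-mono (p⊆p∪q _) EB-in) (chainEdges-in c′)
        λ e∈EB e∈chain → chainEdges-⊈ c′ e∈chain (E⊆S EB-in e∈EB)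
      ∣S∣≤ : ∣ S ∣ ≤ ∣ B ∣ + suc t
      ∣S∣≤ = begin
        ∣ S ∣                        ≤⟨ ∣p∪q∣≤∣p∣+∣q∣ B _ ⟩
        ∣ B ∣ + ∣ listSet prefix ∣    ≤⟨ +-monoʳ-≤ ∣ B ∣ (∣listSet∣≤length prefix) ⟩
        ∣ B ∣ + length prefix        ≡⟨ cong (∣ B ∣ +_) length-prefix ⟩
        ∣ B ∣ + suc t                ∎
        where open ≤-Reasoning
      ∣S∣≤2∣E∣ : ∣ S ∣ ≤ 2 * length E
      ∣S∣≤2∣E∣ = begin
        ∣ S ∣                                ≤⟨ ∣S∣≤ ⟩
        ∣ B ∣ + suc t                        ≤⟨ +-monoˡ-≤ (suc t) ∣B∣≤ ⟩
        suc t + 2 * length EB + suc t        ≡⟨ regroup (suc t) (length EB) ⟩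
        2 * (length EB + suc t)              ≡⟨ cong (λ l → 2 * (length EB + l)) (sym length-c′) ⟩
        2 * (length EB + length (chainEdges c′)) ≡⟨ cong (2 *_) (sym (length-++ EB)) ⟩
        2 * length E                         ∎
        where
        open ≤-Reasoning
        length-c′ : length (chainEdges c′) ≡ suc t
        length-c′ = trans (chainEdges-length c′) length-prefix
        regroup : ∀ s e → s + 2 * e + s ≡ 2 * (e + s)
        regroup = solve-∀
      ∣S∣≤4k : ∣ S ∣ ≤ 2 * (2 * k)
      ∣S∣≤4k = ≤-trans ∣S∣≤ (≤-trans (+-monoˡ-≤ (suc t) ∣B∣≤′) (t<k⇒2t+1+t+1≤4k t<k))

    closure-chain-short : ∀ {X X̄} → ∣ X ∣ < k → IsClosure H X X̄ →
      ∃[ xs ] (Chain NewlyAttracted X xs × X̄ ≡ X ∪ listSet xs × length xs ≤ ∣ X ∣)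
    closure-chain-short {X} ∣X∣<k X̄-closure with closureChain X
    ... | xs , c , closed =
      xs , c , closure≡chain X̄-closure c closed ,
      chain-short c EdgesIn-[] ∣ X ∣ ∣X∣<k
        (≤-trans (n≤1+n _) (m≤m+n _ 0)) (≤-trans (m≤n*m _ 2) (n≤1+n _))

    extension-chain-short : ∀ {X X̄ z₀ Z} → ∣ X ∣ < k → IsClosure H X X̄ →
      IsClosure H (X̄ ∪ ⁅ z₀ ⁆) Z →
      ∃[ zs ] (Chain NewlyAttracted (X̄ ∪ ⁅ z₀ ⁆) zs × Z ≡ (X̄ ∪ ⁅ z₀ ⁆) ∪ listSet zs ×
               length zs ≤ ∣ X ∣)
    extension-chain-short {X} {X̄} {z₀} ∣X∣<k X̄-closure Z-closure
      with closure-chain-short ∣X∣<k X̄-closure | closureChain (X̄ ∪ ⁅ z₀ ⁆)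
    ... | xs , cX , X̄≡ , m≤s | zs , cZ , closed =
      zs , cZ , closure≡chain Z-closure cZ closed , chain-short cZ X̄-edges s ∣X∣<k ∣Y∣≤₁ ∣Y∣≤₂
      where
      open ≤-Reasoning
      s = ∣ X ∣
      m = length xs
      ∣Y∣≤ : ∣ X̄ ∪ ⁅ z₀ ⁆ ∣ ≤ suc (s + m)
      ∣Y∣≤ = begin
        ∣ X̄ ∪ ⁅ z₀ ⁆ ∣              ≤⟨ ∣p∪⁅x⁆∣≤1+∣p∣ X̄ z₀ ⟩
        suc ∣ X̄ ∣                  ≡⟨ cong (suc ∘ ∣_∣) X̄≡ ⟩
        suc ∣ X ∪ listSet xs ∣      ≤⟨ s≤s (∣p∪q∣≤∣p∣+∣q∣ X _) ⟩
        suc (s + ∣ listSet xs ∣)    ≤⟨ s≤s (+-monoʳ-≤ s (∣listSet∣≤length xs)) ⟩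
        suc (s + m)                ∎
      X̄-edges : EdgesIn (X̄ ∪ ⁅ z₀ ⁆) (chainEdges cX)
      X̄-edges = EdgesIn-mono (p⊆p∪q _ ∘ ⊆-reflexive (sym X̄≡)) (chainEdges-in cX)
      ∣Y∣≤₁ : ∣ X̄ ∪ ⁅ z₀ ⁆ ∣ ≤ suc s + 2 * length (chainEdges cX)
      ∣Y∣≤₁ = begin
        ∣ X̄ ∪ ⁅ z₀ ⁆ ∣                     ≤⟨ ∣Y∣≤ ⟩
        suc (s + m)                        ≤⟨ s≤s (+-monoʳ-≤ s (m≤n*m m 2)) ⟩
        suc (s + 2 * m)                    ≡⟨ cong (λ l → suc (s + 2 * l)) (chainEdges-length cX) ⟨
        suc s + 2 * length (chainEdges cX) ∎
      ∣Y∣≤₂ : ∣ X̄ ∪ ⁅ z₀ ⁆ ∣ ≤ suc (2 * s)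
      ∣Y∣≤₂ = begin
        ∣ X̄ ∪ ⁅ z₀ ⁆ ∣   ≤⟨ ∣Y∣≤ ⟩
        suc (s + m)     ≤⟨ s≤s (+-monoʳ-≤ s m≤s) ⟩
        suc (s + s)     ≡⟨ cong (λ l → suc (s + l)) (+-identityʳ s) ⟨
        suc (2 * s)     ∎

  module _ {X̄ : Subset n} (X̄-closed : Closed H X̄) where

    -- W is z₀ together with the ℓ attracting hyperedges adjoined so far; a hyperedge
    -- attracting z to B adds z and at most one further vertex to W (witness-adds-one),
    -- because its other two vertices lie in X̄ ∪ W and, X̄ being closed, not both in X̄.
    record Core (B : Subset n) (ℓ : ℕ) : Set where
      field
        W        : Subset n
        E        : List (Subset n)
        E-in     : EdgesIn W E
        length-E : length E ≡ ℓ
        ∣W∣≤     : ∣ W ∣ ≤ suc (2 * ℓ)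
        W⊆B      : W ⊆ B
        X̄⊆B      : X̄ ⊆ B
        B⊆X̄∪W    : B ⊆ X̄ ∪ W

    witness-adds-one : ∀ {B ℓ z h V} (C : Core B ℓ) → z ∉ B → Witnesses H B z h →
      Core.W C ⊆ V → z ∈ V → ∣ V ∪ h ∣ ≤ suc ∣ V ∣
    witness-adds-one {B} {z = z} {h} {V} C z∉B witness W⊆V z∈V =
      let a , b , a∈B , b∈B , h≡ = Witnesses⇒triangle witness
          h∈edges = subst (LM._∈ edges H) h≡ (proj₁ witness)
          c , a∈W∪c , b∈W∪c = ∪-pair-anchor (B⊆X̄∪W a∈B) (B⊆X̄∪W b∈B) λ (a∈X̄ , b∈X̄) →
            z∉B (X̄⊆B (X̄-closed z (a , b , a∈X̄ , b∈X̄ , h∈edges)))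
          h⊆V∪c : h ⊆ V ∪ ⁅ c ⁆
          h⊆V∪c = subst (_⊆ V ∪ ⁅ c ⁆) (sym h≡)
            (triangle-⊆ (∪-monoˡ-⊆ W⊆V a∈W∪c) (∪-monoˡ-⊆ W⊆V b∈W∪c) (p⊆p∪q _ z∈V))
      in ≤-trans (p⊆q⇒∣p∣≤∣q∣ (∪-least (p⊆p∪q _) h⊆V∪c)) (∣p∪⁅x⁆∣≤1+∣p∣ V c)
      where open Core C

    Core-extend : ∀ {B ℓ z h} → Core B ℓ → z ∉ B → Witnesses H B z h → Core (B ∪ ⁅ z ⁆) (suc ℓ)
    Core-extend {B} {ℓ} {z} {h} C z∉B witness = record
      { W        = V ∪ h
      ; E        = h ∷ E
      ; E-in     = EdgesIn-∷ (proj₁ witness) (q⊆p∪q V h)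
                     (λ h∈E → Witnesses⇒⊈ z∉B witness (W⊆B ∘ E⊆S E-in h∈E))
                     (EdgesIn-mono (p⊆p∪q h ∘ p⊆p∪q ⁅ z ⁆) E-in)
      ; length-E = cong suc length-E
      ; ∣W∣≤     = begin
          ∣ V ∪ h ∣              ≤⟨ witness-adds-one C z∉B witness (p⊆p∪q ⁅ z ⁆) z∈V ⟩
          suc ∣ V ∣              ≤⟨ s≤s (∣p∪⁅x⁆∣≤1+∣p∣ W z) ⟩
          suc (suc ∣ W ∣)        ≤⟨ s≤s (s≤s ∣W∣≤) ⟩
          suc (suc (suc (2 * ℓ))) ≡⟨ cong suc (*-distribˡ-+ 2 1 ℓ) ⟨
          suc (2 * suc ℓ)        ∎
      ; W⊆B      = ∪-least (∪-monoˡ-⊆ W⊆B) (Witnesses⇒⊆∪ witness)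
      ; X̄⊆B      = p⊆p∪q _ ∘ X̄⊆B
      ; B⊆X̄∪W    = ∪-least (∪-least (p⊆p∪q _) (q⊆p∪q X̄ _ ∘ p⊆p∪q h ∘ p⊆p∪q ⁅ z ⁆) ∘ B⊆X̄∪W)
                     (x∈p⇒⁅x⁆⊆p (q⊆p∪q X̄ _ (p⊆p∪q h z∈V)))
      }
      where
      open Core C
      open ≤-Reasoning
      V = W ∪ ⁅ z ⁆
      z∈V : z ∈ V
      z∈V = q⊆p∪q W _ (x∈⁅x⁆ z)

    Core-initial : ∀ {z₀} → Core (X̄ ∪ ⁅ z₀ ⁆) 0
    Core-initial {z₀} = record
      { W        = ⁅ z₀ ⁆
      ; E        = []
      ; E-in     = EdgesIn-[]
      ; length-E = refl
      ; ∣W∣≤     = ≤-reflexive (∣⁅x⁆∣≡1 z₀)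
      ; W⊆B      = q⊆p∪q X̄ _
      ; X̄⊆B      = p⊆p∪q _
      ; B⊆X̄∪W    = ⊆-refl
      }

    module _ {k : ℕ} (meager : Meager H (2 * k)) where

      Core-unique : ∀ {B ℓ z h h′} → Core B ℓ → z ∉ B → suc ℓ < k →
        Witnesses H B z h → Witnesses H B z h′ → h′ ≡ h
      Core-unique {B} {ℓ} {z} {h} {h′} C z∉B ℓ+1<k witness witness′ with h′ ≟ˢ h
      ... | yes h′≡h = h′≡h
      ... | no h′≢h =
        contradiction (meager⇒sparse {l = 2 * k} meager (z , z∈S) ∣S∣≤4k S-edges) (≤⇒≯ ∣S∣≤2∣E∣)
        where
        open Core C
        C′ = Core-extend C z∉B witness
        W′ = Core.W C′
        S = W′ ∪ h′
        W⊆W′ : W ⊆ W′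
        W⊆W′ = p⊆p∪q h ∘ p⊆p∪q ⁅ z ⁆
        z∈W′ : z ∈ W′
        z∈W′ = p⊆p∪q h (q⊆p∪q W _ (x∈⁅x⁆ z))
        z∈S : z ∈ S
        z∈S = p⊆p∪q h′ z∈W′
        h′∉h∷E : ¬ h′ LM.∈ h ∷ E
        h′∉h∷E (here h′≡h)  = h′≢h h′≡h
        h′∉h∷E (there h′∈E) = Witnesses⇒⊈ z∉B witness′ (W⊆B ∘ E⊆S E-in h′∈E)
        S-edges : EdgesIn S (h′ ∷ h ∷ E)
        S-edges = EdgesIn-∷ (proj₁ witness′) (q⊆p∪q W′ h′) h′∉h∷E
                    (EdgesIn-mono (p⊆p∪q h′) (Core.E-in C′))
        ∣S∣≤ : ∣ S ∣ ≤ 2 * suc (suc ℓ)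
        ∣S∣≤ = begin
          ∣ W′ ∪ h′ ∣             ≤⟨ witness-adds-one C z∉B witness′ W⊆W′ z∈W′ ⟩
          suc ∣ W′ ∣              ≤⟨ s≤s (Core.∣W∣≤ C′) ⟩
          suc (suc (2 * suc ℓ))   ≡⟨ *-distribˡ-+ 2 1 (suc ℓ) ⟨
          2 * suc (suc ℓ)         ∎
          where open ≤-Reasoning
        ∣S∣≤2∣E∣ : ∣ S ∣ ≤ 2 * length (h′ ∷ h ∷ E)
        ∣S∣≤2∣E∣ = subst (λ l → ∣ S ∣ ≤ 2 * suc (suc l)) (sym length-E) ∣S∣≤
        ∣S∣≤4k : ∣ S ∣ ≤ 2 * (2 * k)
        ∣S∣≤4k = ≤-trans ∣S∣≤ (*-monoʳ-≤ 2 (≤-trans ℓ+1<k (m≤n*m k 2)))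

      chain-uniquely-attracted : ∀ {B ℓ zs} → Core B ℓ → Chain NewlyAttracted B zs →
        ℓ + length zs < k → Chain UniquelyAttracted B zs
      chain-uniquely-attracted C [] _ = []
      chain-uniquely-attracted {ℓ = ℓ} {z ∷ zs} C ((z∉B , att) ∷ c) bound =
        (att , attractingEdge att , witness , λ _ → Core-unique C z∉B ℓ+1<k witness)
        ∷ chain-uniquely-attracted (Core-extend C z∉B witness) c
            (subst (_< k) (+-suc ℓ (length zs)) bound)
        where
        witness = attractingEdge-witnesses att
        ℓ+1<k : suc ℓ < k
        ℓ+1<k = ≤-<-trans (m<m+n ℓ z<s) bound

theorem2p4p1 : ∀ {n} → 1 ≤ n → (H : Hypergraph n) → (k : ℕ) → 1 ≤ k →
    Meager H (2 * k) →
    (X : Subset n) → ∣ X ∣ < k →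
    (X̄ : Subset n) → IsClosure H X X̄ →
    (z₀ : Fin n) → z₀ ∉ X̄ →
    (Z : Subset n) → IsClosure H (X̄ ∪ ⁅ z₀ ⁆) Z →
    ∣ Z ─ (X̄ ∪ ⁅ z₀ ⁆) ∣ < k ×
    ∃[ zs ] (Unique zs ×
             (∀ v → (v ∈ Z ─ (X̄ ∪ ⁅ z₀ ⁆)) ⇔ (v LM.∈ zs)) ×
             (∀ (j : Fin (length zs)) →
                Attracts H ((X̄ ∪ ⁅ z₀ ⁆) ∪ listSet (take (toℕ j) zs)) (lookup zs j) ×
                ∃[ h ] (Witnesses H ((X̄ ∪ ⁅ z₀ ⁆) ∪ listSet (take (toℕ j) zs)) (lookup zs j) h ×
                        (∀ h′ → Witnesses H ((X̄ ∪ ⁅ z₀ ⁆) ∪ listSet (take (toℕ j) zs)) (lookup zs j) h′ → h′ ≡ h))))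
theorem2p4p1 _ H k _ meager X ∣X∣<k X̄ X̄-closure z₀ _ Z Z-closure
  with extension-chain-short H meager ∣X∣<k X̄-closure Z-closure
... | zs , c , Z≡Y∪zs , p≤∣X∣ =
  ∣Z─Y∣<k , zs , chain-unique H c , Z─Y⇔zs ,
  Chain-lookup (chain-uniquely-attracted H X̄-closed meager (Core-initial H X̄-closed) c p<k)
  where
  Y = X̄ ∪ ⁅ z₀ ⁆
  X̄-closed = proj₁ X̄-closure
  p<k : length zs < k
  p<k = ≤-<-trans p≤∣X∣ ∣X∣<k
  Z─Y⇔zs : ∀ v → v ∈ Z ─ Y ⇔ v LM.∈ zs
  Z─Y⇔zs = subst (λ C → ∀ v → v ∈ C ─ Y ⇔ v LM.∈ zs) (sym Z≡Y∪zs) (chain-new⇔ H c)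
  ∣Z─Y∣<k : ∣ Z ─ Y ∣ < k
  ∣Z─Y∣<k = begin-strict
    ∣ Z ─ Y ∣           ≤⟨ p⊆q⇒∣p∣≤∣q∣ (λ {v} → listSet⁺ ∘ Equivalence.to (Z─Y⇔zs v)) ⟩
    ∣ listSet zs ∣      ≤⟨ ∣listSet∣≤length zs ⟩
    length zs           <⟨ p<k ⟩
    k                   ∎
    where open ≤-Reasoning
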